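{- Let $q$ be a prime power, $n\ge1$, and $M$ an rref over $\mathbb{F}_q$ with $n$ columns. Let $j<i$ be inessential columns of $M$ with $j$ nonpivotal, and let $N$ be the section of $M$ at $j$, of size $m\times(n-j)$. (i) If $i$ is nonpivotal and $N'$ is the section at $j$ of $\mathrm{ins}(M,i)$, then $N'$ has size $m\times(n-j)$, and for every $S\subseteq\{1,\dots,m\}$ the rows of $N$ indexed by $S$ are linearly independent if and only if the rows of $N'$ indexed by $S$ are. (ii) If $i$ is pivotal and $N'$ is the section at $j$ of $\mathrm{del}(M,i)$, then $N'$ has size $m\times(n-j)$, and for every $S\subseteq\{1,\dots,m\}$ the rows of $N$ indexed by $S$ are linearly independent if and only if the rows of $N'$ indexed by $S$ are.
   Context: A $k\times n$ matrix is in rref if every row is nonzero with leading entry $1$ in column $p_i$ for row $i$, $p_1<\cdots<p_k$, and columns $p_1,\dots,p_k$ form the identity (pivotal columns). $C_m[j]$ = first $m$ entries of column $j$, $R_r[i]$ = last $r$ entries of row $i$. The section at a column $j$ is the submatrix formed by the first $m$ rows and last $n-j$ columns, where $m$ is the unique integer with $p_m<j<p_{m+1}$ ($p_0=0$, $p_{k+1}=n+1$) if $j$ is nonpivotal, and $j=p_m$ if $j$ is pivotal. Column $j$ is essential if: when nonpivotal with $p_m<j<p_{m+1}$, $C_m[j]\notin\operatorname{span}\{C_m[j+1],\dots,C_m[n]\}$; when $j=p_m$, $R_{n-j}[m]\notin\operatorname{span}\{R_{n-j}[1],\dots,R_{n-j}[m-1]\}$; otherwise inessential. Lexically first basis of rows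 $r_1,\dots,r_t$: indices $i_1<\cdots<i_s$, $i_1$ least index of a nonzero row, $i_{l+1}$ least index $>i_l$ with $r_{i_{l+1}}\notin\operatorname{span}\{r_{i_1},\dots,r_{i_l}\}$. $\Gamma(b,c)=I_s+b^Tc$. Bijections $\phi_s$ of $\mathbb{F}_q^s$: for $d\ne0$, $\mu_d(0)=1$, $\mu_d(x)=1+dx^{ -1}$ ($x\ne0$); $\phi_1=\mu_{ -1}$; $\phi_{s+1}(b_1,\dots,b_{s+1})=(c_1,\dots,c_s,\mu_\alpha(b_{s+1}))$ with $(c_1,\dots,c_s)=\phi_s(b_1,\dots,b_s)$, $\alpha=-1-\sum b_ic_i$; $\Gamma(b,\phi_s(b))$ is always invertible. Deletion $\mathrm{del}(M,i)$ for inessential pivotal $i=p_r$: $N_0$ = rows $1..r-1$, columns $i+1..n$; $a=R_{n-i}[r]$; $i_1<\dots<i_s$ lexically first basis indices of rows of $N_0$, $N_L$ those rows; $c$ unique with $a=cN_L$; $b=\phi_s^{ -1}(c)$; $d\in\mathbb{F}_q^{r-1}$ with $d_{i_l}=b_l$ and for other $u$, $d_u=\sum_l\alpha_lb_l$ where row $u$ of $N_0$ is $\sum_l\alpha_l(\text{row } i_l)$; add $d_l$ times row $r$ to row $l$ ($l=1..r-1$), then delete row $r$. Insertion $\mathrm{ins}(M,i)$ for inessential nonpivotal $i$ with $p_r<i<p_{r+1}$: $N_0$ = rows $1..r$, columns $i+1..n$; $d=C_r[i]$; $i_1<\dots<i_s$, $N_L$ as before; $b=(d_{i_1},\dots,d_{i_s})$,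 $c=\phi_s(b)$, $a=c\Gamma(b,c)^{ -1}N_L$; insert after row $r$ the row with zeros in columns $1..i-1$, $1$ in column $i$, $a$ in columns $i+1..n$; then for $l=1..r$ subtract $d_l$ times it from row $l$. -}

module Defs where

open import Level using (0ℓ)
open import Data.Nat as ℕ using (ℕ; zero; suc; _^_; _∸_; z≤n; s≤s)
open import Data.Nat.Properties using (m+[n∸m]≡n; ≤-refl; m≤n⇒m≤1+n)
open import Data.Nat.Primality using (Prime)
open import Data.Fin as Fin using (Fin; toℕ; inject≤; punchIn; fromℕ<; cast; _↑ʳ_; inject)
open import Data.Fin.Properties using (toℕ<n)
open import Data.Fin.Subset using (Subset; _∉_)
open import Data.Bool using (Bool; true; false; if_then_else_)
open import Data.Product using (Σ; Σ-syntax; ∃₂; _×_; _,_)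
open import Data.Sum using (_⊎_)
open import Relation.Nullary using (¬_; Dec; yes; no)
open import Relation.Nullary.Decidable using (⌊_⌋)
open import Relation.Binary.PropositionalEquality using (_≡_; _≢_; refl; sym; trans; cong)
open import Relation.Binary.Definitions using (DecidableEquality)
open import Algebra.Core using (Op₁; Op₂)
open import Algebra.Structures using (IsCommutativeRing)
open import Function.Bundles using (_↔_; Inverse)

record FiniteField : Set₁ where
  infixl 7 _*_
  infixl 6 _+_
  field
    Carrier  : Set
    _+_ _*_  : Op₂ Carrier
    -_       : Op₁ Carrier
    0# 1#    : Carrier
    _⁻¹      : Op₁ Carrier      -- value at 0# is irrelevant
    isCommutativeRing : IsCommutativeRing _≡_ _+_ _*_ -_ 0# 1#
    0≢1      : 0# ≢ 1#
    ⁻¹-inverse : ∀ x → x ≢ 0# → x * (x ⁻¹) ≡ 1#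
    q        : ℕ
    enum     : Carrier ↔ Fin q
    q-primePower : ∃₂ λ p e → Prime p × q ≡ p ^ suc e

  _≟_ : DecidableEquality Carrier
  x ≟ y with Inverse.to enum x Fin.≟ Inverse.to enum y
  ... | yes e = yes (trans (sym (Inverse.strictlyInverseʳ enum x))
                     (trans (cong (Inverse.from enum) e) (Inverse.strictlyInverseʳ enum y)))
  ... | no ne = no (λ eq → ne (cong (Inverse.to enum) eq))

-- Everything below is over a fixed finite field.  Indices are 0-based:
-- row r : Fin k is row r+1 of the paper, column c : Fin n is column c+1.

module Over (𝔽 : FiniteField) where
  open FiniteField 𝔽

  F = Carrier

  Mat : ℕ → ℕ → Set
  Mat k n = Fin k → Fin n → F

  sumF : ∀ {t} → (Fin t → F) → F
  sumF {zero}  f = 0#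
  sumF {suc t} f = f Fin.zero + sumF (λ x → f (Fin.suc x))

  record IsRREF {k n} (M : Mat k n) (p : Fin k → Fin n) : Set where
    field
      increasing : ∀ r r' → toℕ r ℕ.< toℕ r' → toℕ (p r) ℕ.< toℕ (p r')
      zeroBefore : ∀ r c → toℕ c ℕ.< toℕ (p r) → M r c ≡ 0#
      leadingOne : ∀ r → M r (p r) ≡ 1#
      pivotCol   : ∀ r r' → r' ≢ r → M r' (p r) ≡ 0#

  Pivotal : ∀ {k n} → (Fin k → Fin n) → Fin n → Set
  Pivotal p j = Σ[ r ∈ Fin _ ] p r ≡ j

  NonPivotal : ∀ {k n} → (Fin k → Fin n) → Fin n → Set
  NonPivotal p j = ¬ Pivotal p j

  -- m = number of pivots in columns ≤ j (this is the m of the paper in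
  -- both cases: p_m < j < p_{m+1}, resp. j = p_m)
  secRows : ∀ {k n} → (Fin k → Fin n) → Fin n → ℕ
  secRows {zero}  p j = 0
  secRows {suc k} p j with toℕ (p Fin.zero) ℕ.≤? toℕ j
  ... | yes _ = suc (secRows (λ x → p (Fin.suc x)) j)
  ... | no  _ = secRows (λ x → p (Fin.suc x)) j

  secRows≤ : ∀ {k n} (p : Fin k → Fin n) j → secRows p j ℕ.≤ k
  secRows≤ {zero}  p j = z≤n
  secRows≤ {suc k} p j with toℕ (p Fin.zero) ℕ.≤? toℕ j
  ... | yes _ = s≤s (secRows≤ (λ x → p (Fin.suc x)) j)
  ... | no  _ = m≤n⇒m≤1+n (secRows≤ (λ x → p (Fin.suc x)) j)

  -- the columns after column j (paper: columns j+1,…,n), as Fin (n - j)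
  shift : ∀ {n} (j : Fin n) → Fin (n ∸ suc (toℕ j)) → Fin n
  shift {n} j c = cast (m+[n∸m]≡n (toℕ<n j)) (suc (toℕ j) ↑ʳ c)

  Section : ∀ {k n} (M : Mat k n) (p : Fin k → Fin n) (j : Fin n) →
            Mat (secRows p j) (n ∸ suc (toℕ j))
  Section M p j x c = M (inject≤ x (secRows≤ p j)) (shift j c)

  -- C_m[j] ∈ span{C_m[j+1],…,C_m[n]}
  ColInSpan : ∀ {k n} → Mat k n → ℕ → Fin n → Set
  ColInSpan {k} {n} M m j =
    Σ[ γ ∈ (Fin n → F) ] ((∀ c → toℕ c ℕ.≤ toℕ j → γ c ≡ 0#) ×
      (∀ (x : Fin k) → toℕ x ℕ.< m → M x j ≡ sumF (λ c → γ c * M x c)))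

  -- R_{n-j}[r] ∈ span{R_{n-j}[x] : x before r}
  RowInSpan : ∀ {k n} → Mat k n → Fin k → Fin n → Set
  RowInSpan {k} {n} M r j =
    Σ[ γ ∈ (Fin k → F) ] ((∀ x → toℕ r ℕ.≤ toℕ x → γ x ≡ 0#) ×
      (∀ c → toℕ j ℕ.< toℕ c → M r c ≡ sumF (λ x → γ x * M x c)))

  Essential : ∀ {k n} → Mat k n → (Fin k → Fin n) → Fin n → Set
  Essential M p j =
    (NonPivotal p j × ¬ ColInSpan M (secRows p j) j)
    ⊎ (Σ[ r ∈ Fin _ ] (p r ≡ j × ¬ RowInSpan M r j))

  Inessential : ∀ {k n} → Mat k n → (Fin k → Fin n) → Fin n → Set
  Inessential M p j = ¬ Essential M p j

  InSpanBelow : ∀ {t w s} → Mat t w → (Fin s → Fin t) → ℕ → (Fin w → F) → Set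
  InSpanBelow {t} {w} {s} A idx lim v =
    Σ[ γ ∈ (Fin s → F) ] ((∀ l → lim ℕ.≤ toℕ (idx l) → γ l ≡ 0#) ×
      (∀ c → v c ≡ sumF (λ l → γ l * A (idx l) c)))

  record IsLexFirstBasis {t w} (A : Mat t w) (s : ℕ) (idx : Fin s → Fin t) : Set where
    field
      increasing : ∀ l l' → toℕ l ℕ.< toℕ l' → toℕ (idx l) ℕ.< toℕ (idx l')
      chosen     : ∀ l → ¬ InSpanBelow A idx (toℕ (idx l)) (A (idx l))
      skipped    : ∀ u → (∀ l → idx l ≢ u) → InSpanBelow A idx (toℕ u) (A u)

  μ : F → F → F
  μ d x with x ≟ 0#
  ... | yes _ = 1#
  ... | no  _ = 1# + d * (x ⁻¹)

  φ : ∀ s → (Fin s → F) → (Fin s → F)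
  φ zero    b = b
  φ (suc s) b = go
    where
      b₀ : Fin s → F
      b₀ x = b (Fin.inject₁ x)
      c₀ : Fin s → F
      c₀ = φ s b₀
      α : F
      α = - 1# + - sumF (λ x → b₀ x * c₀ x)
      go : Fin (suc s) → F
      go x with s ℕ.≟ toℕ x
      ... | yes _  = μ α (b (Fin.fromℕ s))
      ... | no  ne = c₀ (Fin.lower₁ x ne)

  Γ : ∀ {s} → (Fin s → F) → (Fin s → F) → Mat s s
  Γ b c u v = (if ⌊ u Fin.≟ v ⌋ then 1# else 0#) + b u * c v

  -- Insertion ins(M,i), i nonpivotal with p_r < i < p_{r+1}
  -- (r = secRows p i).  IsIns M p i M' means M' = ins(M,i).

  module InsData {k n} (M : Mat k n) (p : Fin k → Fin n) (i : Fin n) where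
    r : ℕ
    r = secRows p i
    row : Fin r → Fin k
    row x = inject≤ x (secRows≤ p i)
    N₀ : Mat r (n ∸ suc (toℕ i))
    N₀ x c = M (row x) (shift i c)
    d : Fin r → F
    d x = M (row x) i
    newPos : Fin (suc k)
    newPos = fromℕ< (s≤s (secRows≤ p i))

  record IsIns {k n} (M : Mat k n) (p : Fin k → Fin n) (i : Fin n)
               (M' : Mat (suc k) n) : Set where
    open InsData M p i
    field
      s     : ℕ
      idx   : Fin s → Fin r
      basis : IsLexFirstBasis N₀ s idx
    b : Fin s → F
    b l = d (idx l)
    c : Fin s → F
    c = φ s b
    field
      g     : Fin s → F
      gΓ≡c  : ∀ v → sumF (λ u → g u * Γ b c u v) ≡ c v
    a : Fin (n ∸ suc (toℕ i)) → F
    a col = sumF (λ l → g l * N₀ (idx l) col)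
    field
      new-before : ∀ col → toℕ col ℕ.< toℕ i → M' newPos col ≡ 0#
      new-at     : M' newPos i ≡ 1#
      new-after  : ∀ col → M' newPos (shift i col) ≡ a col
      old-rows   : ∀ (y : Fin k) col →
        M' (punchIn newPos y) col ≡
          M y col + - ((if ⌊ toℕ y ℕ.<? r ⌋ then M y i else 0#) * M' newPos col)

  -- Deletion del(M,i), i = p_r pivotal.  IsDel M p r M' means M' = del(M,p r).

  skip : ∀ {k} → Fin k → Fin (ℕ.pred k) → Fin k
  skip {suc k} r y = punchIn r y

  module DelData {k n} (M : Mat k n) (p : Fin k → Fin n) (r : Fin k) where
    i : Fin n
    i = p r
    N₀ : Mat (toℕ r) (n ∸ suc (toℕ i))
    N₀ x col = M (inject x) (shift i col)
    a : Fin (n ∸ suc (toℕ i)) → F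
    a col = M r (shift i col)

  record IsDel {k n} (M : Mat k n) (p : Fin k → Fin n) (r : Fin k)
               (M' : Mat (ℕ.pred k) n) : Set where
    open DelData M p r
    field
      s     : ℕ
      idx   : Fin s → Fin (toℕ r)
      basis : IsLexFirstBasis N₀ s idx
      c     : Fin s → F
      a≡cN  : ∀ col → a col ≡ sumF (λ l → c l * N₀ (idx l) col)
      b     : Fin s → F
      φb≡c  : ∀ l → φ s b l ≡ c l
      -- d, extended by 0 to the rows r, r+1, …
      d       : Fin k → F
      d-basis : ∀ l → d (inject (idx l)) ≡ b l
      d-other : ∀ (u : Fin (toℕ r)) → (∀ l → idx l ≢ u) →
                Σ[ α ∈ (Fin s → F) ]
                  ((∀ col → N₀ u col ≡ sumF (λ l → α l * N₀ (idx l) col)) ×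
                   d (inject u) ≡ sumF (λ l → α l * b l))
      d-zero  : ∀ x → toℕ r ℕ.≤ toℕ x → d x ≡ 0#
      rows    : ∀ (y : Fin (ℕ.pred k)) col →
                M' y col ≡ M (skip r y) col + d (skip r y) * M r col

  RowsIndep : ∀ {m w} → Mat m w → Subset m → Set
  RowsIndep {m} {w} A S =
    ∀ (γ : Fin m → F) → (∀ x → x ∉ S → γ x ≡ 0#) →
    (∀ col → sumF (λ x → γ x * A x col) ≡ 0#) → ∀ x → γ x ≡ 0#

-- On the first m rows and the columns after j, both operations change M by a rank-one term:
-- ins(M,i) subtracts M_{x,i} times the inserted row W, del(M,p_r) adds d_x times row r.
-- So the two sections have the same row relations γ as soon as every relation of either
-- section satisfies Σ γ_x u_x = 0 for the coefficient vector u of the update.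
-- Insertion: a relation of N kills u because column i > j is a column of N; for a relation of N',
-- t = Σ γ_x M_{x,i} satisfies t = t (g·b) by inessentiality of column i, where g Γ(b,c) = c,
-- and g·b = 1 would force g = 0.  Deletion: a relation of N' kills u in the pivot column p_r;
-- for a relation of N, the rows of N₀ and the vector d have the same coordinates with respect
-- to the lexically first basis, which is independent.  The size m stays the same because the
-- inserted or deleted row vanishes in the columns up to j.

module Submission where

open import Defs
open import Level using (0ℓ)
open import Data.Nat as ℕ using (ℕ; zero; suc; _≤_; _<_; _∸_; pred; z≤n; s≤s)
import Data.Nat.Properties as ℕ
open import Data.Fin as Fin using (Fin; toℕ; punchIn; inject≤)
import Data.Fin.Properties as Fin
open import Data.Fin.Subset using (Subset)
open import Data.Product using (Σ; _×_; _,_; proj₁; proj₂)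
open import Data.Empty using (⊥-elim)
open import Data.Sum using (inj₁; [_,_]′)
open import Relation.Nullary using (¬_; yes; no)
open import Relation.Nullary.Decidable using (⌊_⌋)
open import Data.Bool using (if_then_else_)
open import Relation.Binary.PropositionalEquality
  using (_≡_; _≢_; refl; sym; trans; cong; cong₂; subst; module ≡-Reasoning)
open import Function.Bundles using (_⇔_; mk⇔; Equivalence)
import Function.Properties.Equivalence as ⇔
open import Algebra.Bundles using (CommutativeRing)
open import Induction.WellFounded using (module All)
open import Data.Fin.Induction using (>-wellFounded)
open import Function.Base using (_∘_)

toℕ-punchIn-< : ∀ {k} (r : Fin (suc k)) (y : Fin k) → toℕ y < toℕ r → toℕ (punchIn r y) ≡ toℕ y
toℕ-punchIn-< Fin.zero    y           ()
toℕ-punchIn-< (Fin.suc r) Fin.zero    _         = refl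
toℕ-punchIn-< (Fin.suc r) (Fin.suc y) (s≤s y<r) = cong suc (toℕ-punchIn-< r y y<r)

toℕ≤toℕ-punchIn : ∀ {k} (r : Fin (suc k)) (y : Fin k) → toℕ y ≤ toℕ (punchIn r y)
toℕ≤toℕ-punchIn Fin.zero    y           = ℕ.n≤1+n (toℕ y)
toℕ≤toℕ-punchIn (Fin.suc r) Fin.zero    = z≤n
toℕ≤toℕ-punchIn (Fin.suc r) (Fin.suc y) = s≤s (toℕ≤toℕ-punchIn r y)

toℕ-inject≤-subst : ∀ {a a' k} (eq : a' ≡ a) (x : Fin a) (a'≤k : a' ≤ k) →
                    toℕ (inject≤ (subst Fin (sym eq) x) a'≤k) ≡ toℕ x
toℕ-inject≤-subst refl x a≤k = Fin.toℕ-inject≤ x a≤k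

≤-fromFin : ∀ {k a b} → a ≤ k → (∀ (y : Fin k) → toℕ y < a → toℕ y < b) → a ≤ b
≤-fromFin a≤k below⇒below = ℕ.≮⇒≥ λ b<a →
  let y = Fin.fromℕ< (ℕ.<-≤-trans b<a a≤k)
      toℕy≡b = Fin.toℕ-fromℕ< (ℕ.<-≤-trans b<a a≤k)
  in ℕ.<-irrefl toℕy≡b (below⇒below y (subst (_< _) (sym toℕy≡b) b<a))

module _ (𝔽 : FiniteField) where
  open FiniteField 𝔽
  open Over 𝔽

  commutativeRing : CommutativeRing 0ℓ 0ℓ
  commutativeRing = record { isCommutativeRing = isCommutativeRing }

  open CommutativeRing commutativeRing
    using (+-identityˡ; +-identityʳ; *-comm; *-assoc; distribˡ; zeroˡ; zeroʳ; *-identityˡ; *-identityʳ; -‿inverseˡ;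
           distribʳ; +-commutativeSemigroup; *-commutativeSemigroup; ring)
  open import Algebra.Properties.Ring ring using (-‿distribˡ-*; -‿distribʳ-*; -0#≈0#; -‿involutive; +-identityˡ-unique; +-inverseˡ-unique)
  open import Algebra.Properties.CommutativeSemigroup *-commutativeSemigroup using (x∙yz≈y∙xz)
  open import Algebra.Properties.CommutativeSemigroup +-commutativeSemigroup using () renaming (interchange to +-interchange)

  x+y*z≡x : ∀ x y {z} → z ≡ 0# → x + y * z ≡ x
  x+y*z≡x x y refl = trans (cong (x +_) (zeroʳ y)) (+-identityʳ x)

  x+-[y*z]≡x : ∀ x y {z} → z ≡ 0# → x + - (y * z) ≡ x
  x+-[y*z]≡x x y refl = trans (cong (λ z → x + - z) (zeroʳ y)) (trans (cong (x +_) -0#≈0#) (+-identityʳ x))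

  x+y*-z≡0⇒x≡y*z : ∀ x y z → x + y * - z ≡ 0# → x ≡ y * z
  x+y*-z≡0⇒x≡y*z x y z x+y*-z≡0 =
    trans (+-inverseˡ-unique x _ (trans (cong (x +_) (-‿distribʳ-* y z)) x+y*-z≡0)) (-‿involutive (y * z))

  x≢0⇒x≡x*y⇒y≡1 : ∀ {x y} → x ≢ 0# → x ≡ x * y → y ≡ 1#
  x≢0⇒x≡x*y⇒y≡1 {x} {y} x≢0 x≡xy = begin
    y                  ≡⟨ sym (*-identityˡ y) ⟩
    1# * y             ≡⟨ cong (_* y) (sym (trans (*-comm _ _) (⁻¹-inverse x x≢0))) ⟩
    (x ⁻¹ * x) * y     ≡⟨ *-assoc _ _ _ ⟩
    x ⁻¹ * (x * y)     ≡⟨ cong (x ⁻¹ *_) (sym x≡xy) ⟩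
    x ⁻¹ * x           ≡⟨ trans (*-comm _ _) (⁻¹-inverse x x≢0) ⟩
    1#                 ∎
    where open ≡-Reasoning

  sumF-cong : ∀ {t} {f g : Fin t → F} → (∀ x → f x ≡ g x) → sumF f ≡ sumF g
  sumF-cong {zero}  f≗g = refl
  sumF-cong {suc t} f≗g = cong₂ _+_ (f≗g Fin.zero) (sumF-cong (λ x → f≗g (Fin.suc x)))

  sumF-zero : ∀ {t} {f : Fin t → F} → (∀ x → f x ≡ 0#) → sumF f ≡ 0#
  sumF-zero {zero}  f≗0 = refl
  sumF-zero {suc t} f≗0 = trans (cong₂ _+_ (f≗0 Fin.zero) (sumF-zero (λ x → f≗0 (Fin.suc x)))) (+-identityʳ 0#)

  sumF-+ : ∀ {t} (f g : Fin t → F) → sumF (λ x → f x + g x) ≡ sumF f + sumF g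
  sumF-+ {zero}  f g = sym (+-identityʳ 0#)
  sumF-+ {suc t} f g = trans (cong (f Fin.zero + g Fin.zero +_) (sumF-+ (λ x → f (Fin.suc x)) (λ x → g (Fin.suc x))))
                             (+-interchange _ _ _ _)

  sumF-*ˡ : ∀ {t} a (f : Fin t → F) → sumF (λ x → a * f x) ≡ a * sumF f
  sumF-*ˡ {zero}  a f = sym (zeroʳ a)
  sumF-*ˡ {suc t} a f = trans (cong (a * f Fin.zero +_) (sumF-*ˡ a (λ x → f (Fin.suc x)))) (sym (distribˡ a _ _))

  sumF-*ʳ : ∀ {t} a (f : Fin t → F) → sumF (λ x → f x * a) ≡ sumF f * a
  sumF-*ʳ a f = trans (sumF-cong (λ x → *-comm (f x) a)) (trans (sumF-*ˡ a f) (*-comm a _))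

  sumF-comm : ∀ {t u} (f : Fin t → Fin u → F) →
              sumF (λ x → sumF (f x)) ≡ sumF (λ y → sumF (λ x → f x y))
  sumF-comm {zero} {u} f = sym (sumF-zero {u} (λ _ → refl))
  sumF-comm {suc t} f = trans (cong (sumF (f Fin.zero) +_) (sumF-comm (λ x → f (Fin.suc x))))
                              (sym (sumF-+ (f Fin.zero) _))

  sumF-single : ∀ {t} {f : Fin t → F} v → (∀ u → u ≢ v → f u ≡ 0#) → sumF f ≡ f v
  sumF-single {suc t} Fin.zero    f≗0 =
    trans (cong (_ +_) (sumF-zero (λ u → f≗0 (Fin.suc u) λ ())) ) (+-identityʳ _)
  sumF-single {suc t} (Fin.suc v) f≗0 =
    trans (cong₂ _+_ (f≗0 Fin.zero λ ()) (sumF-single v (λ u u≢v → f≗0 (Fin.suc u) (u≢v ∘ Fin.suc-injective))))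
          (+-identityˡ _)

  δ : ∀ {s} → Fin s → Fin s → F
  δ u v = if ⌊ u Fin.≟ v ⌋ then 1# else 0#

  δ-≢ : ∀ {s} {u v : Fin s} → u ≢ v → δ u v ≡ 0#
  δ-≢ {u = u} {v} u≢v with u Fin.≟ v
  ... | yes u≡v = ⊥-elim (u≢v u≡v)
  ... | no _    = refl

  δ-refl : ∀ {s} (v : Fin s) → δ v v ≡ 1#
  δ-refl v with v Fin.≟ v
  ... | yes _   = refl
  ... | no v≢v = ⊥-elim (v≢v refl)

  sumF-δ : ∀ {s} (f : Fin s → F) v → sumF (λ u → f u * δ u v) ≡ f v
  sumF-δ f v = trans (sumF-single v (λ u u≢v → trans (cong (f u *_) (δ-≢ u≢v)) (zeroʳ _)))
                     (trans (cong (f v *_) (δ-refl v)) (*-identityʳ _))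

  infix 7 _·_
  _·_ : ∀ {t} → (Fin t → F) → (Fin t → F) → F
  u · v = sumF (λ x → u x * v x)

  ·-comm : ∀ {t} (u v : Fin t → F) → u · v ≡ v · u
  ·-comm u v = sumF-cong (λ x → *-comm (u x) (v x))

  ·-assoc : ∀ {t s} (γ : Fin t → F) (α : Fin t → Fin s → F) (X : Fin s → F) →
            γ · (λ u → α u · X) ≡ (λ l → γ · (λ u → α u l)) · X
  ·-assoc {t} {s} γ α X = begin
    sumF (λ u → γ u * sumF (λ l → α u l * X l))     ≡⟨ sumF-cong (λ u → sym (sumF-*ˡ {s} (γ u) _)) ⟩
    sumF (λ u → sumF (λ l → γ u * (α u l * X l)))   ≡⟨ sumF-comm {t} {s} _ ⟩
    sumF (λ l → sumF (λ u → γ u * (α u l * X l)))   ≡⟨ sumF-cong {s} (λ l → sumF-cong {t} (λ u → sym (*-assoc (γ u) (α u l) (X l)))) ⟩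
    sumF (λ l → sumF (λ u → γ u * α u l * X l))     ≡⟨ sumF-cong (λ l → sumF-*ʳ {t} (X l) _) ⟩
    sumF (λ l → sumF (λ u → γ u * α u l) * X l)     ∎
    where open ≡-Reasoning

  RowRelation : ∀ {m w} → Mat m w → (Fin m → F) → Set
  RowRelation A γ = ∀ c → γ · (λ x → A x c) ≡ 0#

  IndependentRows : ∀ {m w} → Mat m w → Set
  IndependentRows A = ∀ γ → RowRelation A γ → ∀ x → γ x ≡ 0#

  rowsIndep-cong : ∀ {m w} {A B : Mat m w} →
    (∀ γ → RowRelation A γ → RowRelation B γ) → (∀ γ → RowRelation B γ → RowRelation A γ) →
    ∀ S → RowsIndep A S ⇔ RowsIndep B S
  rowsIndep-cong A⇒B B⇒A S = mk⇔ (λ indA γ γ∈S relB → indA γ γ∈S (B⇒A γ relB))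
                                 (λ indB γ γ∈S relA → indB γ γ∈S (A⇒B γ relA))

  ·-rankOne : ∀ {m w} {A B : Mat m w} {u : Fin m → F} {v : Fin w → F} →
    (∀ x c → B x c ≡ A x c + u x * v c) →
    ∀ γ c → γ · (λ x → B x c) ≡ γ · (λ x → A x c) + (γ · u) * v c
  ·-rankOne {m} {A = A} {B} {u} {v} B≡A+uv γ c = begin
    sumF (λ x → γ x * B x c)                             ≡⟨ sumF-cong (λ x → cong (γ x *_) (B≡A+uv x c)) ⟩
    sumF (λ x → γ x * (A x c + u x * v c))               ≡⟨ sumF-cong (λ x → distribˡ (γ x) _ _) ⟩
    sumF (λ x → γ x * A x c + γ x * (u x * v c))         ≡⟨ sumF-+ {m} _ _ ⟩
    γ · (λ x → A x c) + sumF (λ x → γ x * (u x * v c))   ≡⟨ cong (γ · (λ x → A x c) +_)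
                                                             (trans (sumF-cong (λ x → sym (*-assoc (γ x) _ _))) (sumF-*ʳ {m} (v c) _)) ⟩
    γ · (λ x → A x c) + (γ · u) * v c                    ∎
    where open ≡-Reasoning

  rowsIndep-rankOne : ∀ {m w} {A B : Mat m w} {u : Fin m → F} {v : Fin w → F} →
    (∀ x c → B x c ≡ A x c + u x * v c) →
    (∀ γ → RowRelation A γ → γ · u ≡ 0#) → (∀ γ → RowRelation B γ → γ · u ≡ 0#) →
    ∀ S → RowsIndep A S ⇔ RowsIndep B S
  rowsIndep-rankOne {A = A} {B} {u} {v} B≡A+uv relA⇒γu≡0 relB⇒γu≡0 = rowsIndep-cong A⇒B B⇒A
    where
      dropUpdate : ∀ γ → γ · u ≡ 0# → ∀ c → γ · (λ x → B x c) ≡ γ · (λ x → A x c)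
      dropUpdate γ γu≡0 c = trans (·-rankOne B≡A+uv γ c)
                                  (trans (cong (λ t → γ · (λ x → A x c) + t * v c) γu≡0)
                                         (trans (cong (γ · (λ x → A x c) +_) (zeroˡ (v c))) (+-identityʳ _)))
      A⇒B : ∀ γ → RowRelation A γ → RowRelation B γ
      A⇒B γ relA c = trans (dropUpdate γ (relA⇒γu≡0 γ relA) c) (relA c)
      B⇒A : ∀ γ → RowRelation B γ → RowRelation A γ
      B⇒A γ relB c = trans (sym (dropUpdate γ (relB⇒γu≡0 γ relB) c)) (relB c)

  ·-cong-beyond : ∀ {n} {β f h : Fin n → F} (i : Fin n) →
    (∀ c → toℕ c ≤ toℕ i → β c ≡ 0#) → (∀ c → toℕ i < toℕ c → f c ≡ h c) → β · f ≡ β · h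
  ·-cong-beyond {β = β} {f} {h} i β-vanishes f≡h = sumF-cong pointwise
    where
      pointwise : ∀ c → β c * f c ≡ β c * h c
      pointwise c with toℕ c ℕ.≤? toℕ i
      ... | yes c≤i = trans (cong (_* f c) (β-vanishes c c≤i))
                            (trans (zeroˡ (f c)) (sym (trans (cong (_* h c) (β-vanishes c c≤i)) (zeroˡ (h c)))))
      ... | no  c≰i = cong (β c *_) (f≡h c (ℕ.≰⇒> c≰i))

  rowsIndep-subst : ∀ {m m' w} (eq : m' ≡ m) (A : Mat m' w) (S : Subset m) →
    RowsIndep (λ x → A (subst Fin (sym eq) x)) S ⇔ RowsIndep A (subst Subset (sym eq) S)
  rowsIndep-subst refl A S = ⇔.refl

  lexFirstBasis-independent : ∀ {t w s} {A : Mat t w} {idx : Fin s → Fin t} →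
    IsLexFirstBasis A s idx → IndependentRows (λ l → A (idx l))
  lexFirstBasis-independent {s = s} {A} {idx} basis e rel =
    All.wfRec >-wellFounded 0ℓ (λ l → e l ≡ 0#) lastCoefficient-zero
    where
      open IsLexFirstBasis basis
      lastCoefficient-zero : ∀ l → (∀ {l'} → toℕ l < toℕ l' → e l' ≡ 0#) → e l ≡ 0#
      lastCoefficient-zero l later with e l ≟ 0#
      ... | yes el≡0 = el≡0
      ... | no  el≢0 = ⊥-elim (chosen l (γ , γ-vanishes , A-combination))
        where
          -- A (idx l) = - (e l)⁻¹ · Σ_{l' < l} e l' · A (idx l'), contradicting that idx l was chosen
          γ : Fin s → F
          γ l' = - (e l ⁻¹) * e l' + δ l' l
          γ-vanishes : ∀ l' → toℕ (idx l) ≤ toℕ (idx l') → γ l' ≡ 0#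
          γ-vanishes l' idxl≤idxl' with l' Fin.≟ l
          ... | yes refl = begin
            - (e l ⁻¹) * e l + 1#      ≡⟨ cong (_+ 1#) (sym (-‿distribˡ-* _ _)) ⟩
            - (e l ⁻¹ * e l) + 1#      ≡⟨ cong (λ y → - y + 1#) (trans (*-comm _ _) (⁻¹-inverse _ el≢0)) ⟩
            - 1# + 1#                  ≡⟨ -‿inverseˡ 1# ⟩
            0#                         ∎
            where open ≡-Reasoning
          ... | no l'≢l = trans (cong (_+ 0#) (trans (cong (- (e l ⁻¹) *_) (later l<l')) (zeroʳ _))) (+-identityʳ 0#)
            where
              l<l' : toℕ l < toℕ l'
              l<l' = ℕ.≤∧≢⇒< (ℕ.≮⇒≥ (λ l'<l → ℕ.<⇒≱ (increasing l' l l'<l) idxl≤idxl'))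
                             (λ l≡l' → l'≢l (Fin.toℕ-injective (sym l≡l')))
          A-combination : ∀ c → A (idx l) c ≡ γ · (λ l' → A (idx l') c)
          A-combination c = sym (begin
            sumF (λ l' → (- (e l ⁻¹) * e l' + δ l' l) * A (idx l') c)
              ≡⟨ sumF-cong (λ l' → trans (distribʳ (A (idx l') c) _ _) (cong₂ _+_ (*-assoc (- (e l ⁻¹)) _ _) (*-comm (δ l' l) _))) ⟩
            sumF (λ l' → - (e l ⁻¹) * (e l' * A (idx l') c) + A (idx l') c * δ l' l)
              ≡⟨ trans (sumF-+ {s} _ _) (cong₂ _+_ (sumF-*ˡ {s} (- (e l ⁻¹)) _) (sumF-δ _ l)) ⟩
            - (e l ⁻¹) * (e · (λ l' → A (idx l') c)) + A (idx l) c
              ≡⟨ cong (λ y → - (e l ⁻¹) * y + A (idx l) c) (rel c) ⟩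
            - (e l ⁻¹) * 0# + A (idx l) c
              ≡⟨ trans (cong (_+ A (idx l) c) (zeroʳ _)) (+-identityˡ _) ⟩
            A (idx l) c ∎)
            where open ≡-Reasoning

  relation-respects-coordinates : ∀ {t s w} {V : Mat t w} {B : Mat s w} {d : Fin t → F} {b : Fin s → F}
    (α : Fin t → Fin s → F) → IndependentRows B →
    (∀ u c → V u c ≡ α u · (λ l → B l c)) → (∀ u → d u ≡ α u · b) →
    ∀ γ → RowRelation V γ → γ · d ≡ 0#
  relation-respects-coordinates {V = V} {B} {d} {b} α independent V≡αB d≡αb γ rel = begin
    γ · d                      ≡⟨ sumF-cong (λ u → cong (γ u *_) (d≡αb u)) ⟩
    γ · (λ u → α u · b)        ≡⟨ ·-assoc γ α b ⟩
    e · b                      ≡⟨ sumF-zero (λ l → trans (cong (_* b l) (e≡0 l)) (zeroˡ (b l))) ⟩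
    0#                         ∎
    where
      open ≡-Reasoning
      e : _ → F
      e l = γ · (λ u → α u l)
      e≡0 : ∀ l → e l ≡ 0#
      e≡0 = independent e λ c → trans (sym (·-assoc γ α (λ l → B l c)))
                                      (trans (sumF-cong (λ u → cong (γ u *_) (sym (V≡αB u c)))) (rel c))

  xΓ≡c⇒x·b≢1 : ∀ {s} (b c x : Fin s → F) → (∀ v → x · (λ u → Γ b c u v) ≡ c v) → x · b ≢ 1#
  xΓ≡c⇒x·b≢1 {s} b c x xΓ≡c x·b≡1 = 0≢1 (trans (sym (sumF-zero (λ u → trans (cong (_* b u) (x≡0 u)) (zeroˡ _)))) x·b≡1)
    where
      xΓ-expand : ∀ v → x · (λ u → Γ b c u v) ≡ x v + (x · b) * c v
      xΓ-expand v = begin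
        sumF (λ u → x u * (δ u v + b u * c v))          ≡⟨ sumF-cong (λ u → distribˡ (x u) _ _) ⟩
        sumF (λ u → x u * δ u v + x u * (b u * c v))    ≡⟨ sumF-+ {s} _ _ ⟩
        sumF (λ u → x u * δ u v) + sumF (λ u → x u * (b u * c v))
          ≡⟨ cong₂ _+_ (sumF-δ x v) (trans (sumF-cong (λ u → sym (*-assoc (x u) _ _))) (sumF-*ʳ {s} (c v) _)) ⟩
        x v + (x · b) * c v                             ∎
        where open ≡-Reasoning
      x≡0 : ∀ v → x v ≡ 0#
      x≡0 v = +-identityˡ-unique (x v) (c v) (begin
        x v + c v              ≡⟨ cong (x v +_) (sym (trans (cong (_* c v) x·b≡1) (*-identityˡ _))) ⟩
        x v + (x · b) * c v    ≡⟨ sym (xΓ-expand v) ⟩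
        x · (λ u → Γ b c u v)  ≡⟨ xΓ≡c v ⟩
        c v                    ∎)
        where open ≡-Reasoning

  -- Sections of a matrix in rref

  Increasing : ∀ {k n} → (Fin k → Fin n) → Set
  Increasing p = ∀ r r' → toℕ r < toℕ r' → toℕ (p r) < toℕ (p r')

  increasing-reflects-< : ∀ {k n} {p : Fin k → Fin n} → Increasing p →
                          ∀ {y r} → toℕ (p y) < toℕ (p r) → toℕ y < toℕ r
  increasing-reflects-< {p = p} increasing {y} {r} py<pr = ℕ.≰⇒> λ r≤y →
    [ (λ r<y → ℕ.<-asym py<pr (increasing r y r<y))
    , (λ r≡y → ℕ.<-irrefl (cong (λ z → toℕ (p z)) (sym (Fin.toℕ-injective r≡y))) py<pr)
    ]′ (ℕ.m≤n⇒m<n∨m≡n r≤y)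

  secRows-mono : ∀ {k n} (p : Fin k → Fin n) {j i} → toℕ j ≤ toℕ i → secRows p j ≤ secRows p i
  secRows-mono {zero}  p j≤i = z≤n
  secRows-mono {suc k} p {j} {i} j≤i with toℕ (p Fin.zero) ℕ.≤? toℕ j | toℕ (p Fin.zero) ℕ.≤? toℕ i
  ... | yes _     | yes _     = s≤s (secRows-mono (λ x → p (Fin.suc x)) j≤i)
  ... | yes p₀≤j  | no  p₀≰i  = ⊥-elim (p₀≰i (ℕ.≤-trans p₀≤j j≤i))
  ... | no  _     | yes _     = ℕ.m≤n⇒m≤1+n (secRows-mono (λ x → p (Fin.suc x)) j≤i)
  ... | no  _     | no  _     = secRows-mono (λ x → p (Fin.suc x)) j≤i

  secRows-≡0 : ∀ {k n} (p : Fin k → Fin n) j → (∀ x → toℕ j < toℕ (p x)) → secRows p j ≡ 0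
  secRows-≡0 {zero}  p j j<p = refl
  secRows-≡0 {suc k} p j j<p with toℕ (p Fin.zero) ℕ.≤? toℕ j
  ... | yes p₀≤j = ⊥-elim (ℕ.<⇒≱ (j<p Fin.zero) p₀≤j)
  ... | no  _    = secRows-≡0 (λ x → p (Fin.suc x)) j (λ x → j<p (Fin.suc x))

  secRows-spec : ∀ {k n} {p : Fin k → Fin n} → Increasing p →
                 ∀ j x → toℕ x < secRows p j ⇔ toℕ (p x) ≤ toℕ j
  secRows-spec {suc k} {p = p} increasing j x with toℕ (p Fin.zero) ℕ.≤? toℕ j
  ... | yes p₀≤j = mk⇔ (to x) (from x)
    where
      rest = secRows-spec {p = λ x → p (Fin.suc x)} (λ r r' → increasing (Fin.suc r) (Fin.suc r') ∘ s≤s) j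
      to : ∀ x → toℕ x < suc (secRows (λ x → p (Fin.suc x)) j) → toℕ (p x) ≤ toℕ j
      to Fin.zero    _         = p₀≤j
      to (Fin.suc x) (s≤s x<S) = Equivalence.to (rest x) x<S
      from : ∀ x → toℕ (p x) ≤ toℕ j → toℕ x < suc (secRows (λ x → p (Fin.suc x)) j)
      from Fin.zero    _    = s≤s z≤n
      from (Fin.suc x) px≤j = s≤s (Equivalence.from (rest x) px≤j)
  ... | no p₀≰j = mk⇔ (λ x<0 → ⊥-elim (ℕ.n≮0 (subst (toℕ x <_) rest≡0 x<0)))
                      (λ px≤j → ⊥-elim (ℕ.<⇒≱ (j<p x) px≤j))
    where
      j<p : ∀ x → toℕ j < toℕ (p x)
      j<p Fin.zero    = ℕ.≰⇒> p₀≰j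
      j<p (Fin.suc x) = ℕ.<-trans (ℕ.≰⇒> p₀≰j) (increasing Fin.zero (Fin.suc x) (s≤s z≤n))
      rest≡0 : secRows (λ x → p (Fin.suc x)) j ≡ 0
      rest≡0 = secRows-≡0 _ j (λ x → j<p (Fin.suc x))

  toℕ-shift : ∀ {n} (j : Fin n) c → toℕ (shift j c) ≡ suc (toℕ j) ℕ.+ toℕ c
  toℕ-shift j c = trans (Fin.toℕ-cast _ _) (Fin.toℕ-↑ʳ (suc (toℕ j)) c)

  j<shift : ∀ {n} (j : Fin n) c → toℕ j < toℕ (shift j c)
  j<shift j c = subst (toℕ j <_) (sym (toℕ-shift j c)) (s≤s (ℕ.m≤m+n (toℕ j) (toℕ c)))

  shift-onto : ∀ {n} (j c : Fin n) → toℕ j < toℕ c → Σ (Fin (n ∸ suc (toℕ j))) λ c' → shift j c' ≡ c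
  shift-onto {n} j c j<c = c' , Fin.toℕ-injective (begin
    toℕ (shift j c')                   ≡⟨ toℕ-shift j c' ⟩
    suc (toℕ j) ℕ.+ toℕ c'             ≡⟨ cong (suc (toℕ j) ℕ.+_) (Fin.toℕ-fromℕ< c'<n-j) ⟩
    suc (toℕ j) ℕ.+ (toℕ c ∸ suc (toℕ j)) ≡⟨ ℕ.m+[n∸m]≡n j<c ⟩
    toℕ c                              ∎)
    where
      open ≡-Reasoning
      c'<n-j : toℕ c ∸ suc (toℕ j) < n ∸ suc (toℕ j)
      c'<n-j = ℕ.∸-monoˡ-< (Fin.toℕ<n c) j<c
      c' = Fin.fromℕ< c'<n-j

  shift-elim : ∀ {n} (j : Fin n) (P : Fin n → Set) → (∀ c' → P (shift j c')) → ∀ c → toℕ j < toℕ c → P c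
  shift-elim j P P-shift c j<c = subst P (proj₂ (shift-onto j c j<c)) (P-shift _)

  section-relation : ∀ {k n} {M : Mat k n} {p : Fin k → Fin n} {j : Fin n} γ → RowRelation (Section M p j) γ →
                     ∀ col → toℕ j < toℕ col → γ · (λ x → M (inject≤ x (secRows≤ p j)) col) ≡ 0#
  section-relation {M = M} {p} {j} γ rel = shift-elim j (λ col → γ · (λ x → M (inject≤ x (secRows≤ p j)) col) ≡ 0#) rel

  EquivalentSections : ∀ {k k' n} → Mat k n → (Fin k → Fin n) → Mat k' n → (Fin k' → Fin n) → Fin n → Set
  EquivalentSections M p M' p' j =
    Σ (secRows p' j ≡ secRows p j) λ eq →
      ∀ (S : Subset (secRows p j)) → RowsIndep (Section M p j) S ⇔ RowsIndep (Section M' p' j) (subst Subset (sym eq) S)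

  VanishesUpTo : ∀ {k n} → Mat k n → Fin n → Fin k → Set
  VanishesUpTo M j x = ∀ c → toℕ c ≤ toℕ j → M x c ≡ 0#

  module _ {k n} {M : Mat k n} {p : Fin k → Fin n} (rref : IsRREF M p) where
    open IsRREF rref

    <secRows⇒¬vanishes : ∀ {j x} → toℕ x < secRows p j → ¬ VanishesUpTo M j x
    <secRows⇒¬vanishes {j} {x} x<m vanishes =
      0≢1 (trans (sym (vanishes (p x) (Equivalence.to (secRows-spec increasing j x) x<m))) (leadingOne x))

    secRows≤⇒vanishes : ∀ {j x} → secRows p j ≤ toℕ x → VanishesUpTo M j x
    secRows≤⇒vanishes {j} {x} m≤x c c≤j = zeroBefore x c (ℕ.≤-<-trans c≤j j<px)
      where
        j<px : toℕ j < toℕ (p x)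
        j<px = ℕ.≰⇒> λ px≤j → ℕ.<⇒≱ (Equivalence.from (secRows-spec increasing j x) px≤j) m≤x

    secRows-unique : ∀ {j a} → a ≤ k →
      (∀ x → toℕ x < a → ¬ VanishesUpTo M j x) → (∀ x → a ≤ toℕ x → VanishesUpTo M j x) →
      secRows p j ≡ a
    secRows-unique {j} a≤k below above = ℕ.≤-antisym
      (≤-fromFin (secRows≤ p j) λ y y<m → ℕ.≰⇒> λ a≤y → <secRows⇒¬vanishes y<m (above y a≤y))
      (≤-fromFin a≤k λ y y<a → ℕ.≰⇒> λ m≤y → below y y<a (secRows≤⇒vanishes m≤y))

  secRows-deleteVanishingRow : ∀ {k n} {M : Mat (suc k) n} {p} {M' : Mat k n} {p'} →
    IsRREF M p → IsRREF M' p' → ∀ {j} (r : Fin (suc k)) → VanishesUpTo M j r →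
    (∀ y c → toℕ c ≤ toℕ j → M' y c ≡ M (punchIn r y) c) → secRows p' j ≡ secRows p j
  secRows-deleteVanishingRow {M = M} {p} {M'} rref rref' {j} r r-vanishes M'≡M∘punchIn =
    secRows-unique rref' (ℕ.≤-trans m≤r (Fin.toℕ≤pred[n] r)) below above
    where
      m≤r : secRows p j ≤ toℕ r
      m≤r = ℕ.≮⇒≥ λ r<m → <secRows⇒¬vanishes rref r<m r-vanishes
      below : ∀ y → toℕ y < secRows p j → ¬ VanishesUpTo M' j y
      below y y<m vanishes = <secRows⇒¬vanishes rref
        (subst (_< secRows p j) (sym (toℕ-punchIn-< r y (ℕ.<-≤-trans y<m m≤r))) y<m)
        λ c c≤j → trans (sym (M'≡M∘punchIn y c c≤j)) (vanishes c c≤j)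
      above : ∀ y → secRows p j ≤ toℕ y → VanishesUpTo M' j y
      above y m≤y c c≤j =
        trans (M'≡M∘punchIn y c c≤j) (secRows≤⇒vanishes rref (ℕ.≤-trans m≤y (toℕ≤toℕ-punchIn r y)) c c≤j)

  -- Insertion and deletion

  module Insertion {k n} {M : Mat k n} {p : Fin k → Fin n} (rref : IsRREF M p)
    {j i : Fin n} (j<i : toℕ j < toℕ i) (i-inessential : Inessential M p i) (i-nonpivotal : NonPivotal p i)
    {M' : Mat (suc k) n} {p' : Fin (suc k) → Fin n} (ins : IsIns M p i M') (rref' : IsRREF M' p') where

    open InsData M p i using (r; row; newPos)
    open IsIns ins using (idx; b; c; g; gΓ≡c; new-before; new-after; old-rows)

    ρ : Fin (secRows p j) → Fin k
    ρ x = inject≤ x (secRows≤ p j)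

    W : Fin n → F
    W = M' newPos

    ρ<r : ∀ x → toℕ (ρ x) < r
    ρ<r x = subst (_< r) (sym (Fin.toℕ-inject≤ x _)) (ℕ.<-≤-trans (Fin.toℕ<n x) (secRows-mono p (ℕ.<⇒≤ j<i)))

    W-vanishes : VanishesUpTo M' j newPos
    W-vanishes col col≤j = new-before col (ℕ.≤-<-trans col≤j j<i)

    W-beyond-i : ∀ col → toℕ i < toℕ col → W col ≡ (λ l → M (row (idx l)) col) · g
    W-beyond-i = shift-elim i (λ col → W col ≡ (λ l → M (row (idx l)) col) · g)
                            (λ col' → trans (new-after col') (·-comm g _))

    oldRow : ∀ y → toℕ y < r → ∀ col → M' (punchIn newPos y) col ≡ M y col + M y i * - W col
    oldRow y y<r col with toℕ y ℕ.<? r | old-rows y col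
    ... | yes _   | old-row = trans old-row (cong (M y col +_) (-‿distribʳ-* (M y i) (W col)))
    ... | no  y≮r | _       = ⊥-elim (y≮r y<r)

    oldRow-upTo-j : ∀ y col → toℕ col ≤ toℕ j → M' (punchIn newPos y) col ≡ M y col
    oldRow-upTo-j y col col≤j = trans (old-rows y col) (x+-[y*z]≡x _ _ (W-vanishes col col≤j))

    secRows-ins : secRows p' j ≡ secRows p j
    secRows-ins = sym (secRows-deleteVanishingRow rref' rref newPos W-vanishes (λ y col col≤j → sym (oldRow-upTo-j y col col≤j)))

    section-rankOne : ∀ x col → Section M' p' j (subst Fin (sym secRows-ins) x) col ≡
                                Section M p j x col + M (ρ x) i * - W (shift j col)
    section-rankOne x col = trans (cong (λ y → M' y (shift j col)) row≡) (oldRow (ρ x) (ρ<r x) (shift j col))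
      where
        row≡ : inject≤ (subst Fin (sym secRows-ins) x) (secRows≤ p' j) ≡ punchIn newPos (ρ x)
        row≡ = Fin.toℕ-injective (trans (toℕ-inject≤-subst secRows-ins x (secRows≤ p' j)) (sym (trans
                 (toℕ-punchIn-< newPos (ρ x) (subst (toℕ (ρ x) <_) (sym (Fin.toℕ-fromℕ< _)) (ρ<r x)))
                 (Fin.toℕ-inject≤ x _))))

    combination : (Fin (secRows p j) → F) → Fin n → F
    combination γ col = γ · (λ x → M (ρ x) col)

    coefficient-zero : ∀ γ → (∀ col → toℕ j < toℕ col → combination γ col ≡ combination γ i * W col) →
                       combination γ i ≡ 0#
    coefficient-zero γ combination≡tW with combination γ i ≟ 0#
    ... | yes t≡0 = t≡0
    ... | no  t≢0 = ⊥-elim (i-inessential (inj₁ (i-nonpivotal , λ span →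
                      xΓ≡c⇒x·b≢1 b c g gΓ≡c (x≢0⇒x≡x*y⇒y≡1 t≢0 (t≡t*[g·b] span)))))
      where
        t = combination γ i
        -- β writes column i through the later columns; apply it to the γ-combination (which is t · W
        -- there) and to W = Σ_l g l · row (idx l)
        t≡t*[g·b] : ColInSpan M r i → t ≡ t * (g · b)
        t≡t*[g·b] (β , β-vanishes , column-i) = begin
          γ · (λ x → M (ρ x) i)                               ≡⟨ sumF-cong (λ x → cong (γ x *_) (column-i (ρ x) (ρ<r x))) ⟩
          γ · (λ x → β · M (ρ x))                             ≡⟨ sumF-cong (λ x → cong (γ x *_) (·-comm β (M (ρ x)))) ⟩
          γ · (λ x → M (ρ x) · β)                             ≡⟨ ·-assoc γ (λ x → M (ρ x)) β ⟩
          (λ col → combination γ col) · β                     ≡⟨ ·-comm _ β ⟩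
          β · (λ col → combination γ col)                     ≡⟨ ·-cong-beyond i β-vanishes (λ col i<col → combination≡tW col (ℕ.<-trans j<i i<col)) ⟩
          β · (λ col → t * W col)                             ≡⟨ trans (sumF-cong (λ col → x∙yz≈y∙xz (β col) t (W col))) (sumF-*ˡ {n} t _) ⟩
          t * (β · W)                                         ≡⟨ cong (t *_) (·-cong-beyond i β-vanishes W-beyond-i) ⟩
          t * (β · (λ col → (λ l → M (row (idx l)) col) · g)) ≡⟨ cong (t *_) (·-assoc β (λ col l → M (row (idx l)) col) g) ⟩
          t * ((λ l → β · M (row (idx l))) · g)               ≡⟨ cong (t *_) (sumF-cong (λ l → cong (_* g l) (sym (column-i (row (idx l)) (row<r l))))) ⟩
          t * (b · g)                                         ≡⟨ cong (t *_) (·-comm b g) ⟩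
          t * (g · b)                                         ∎
          where
            open ≡-Reasoning
            row<r : ∀ l → toℕ (row (idx l)) < r
            row<r l = subst (_< r) (sym (Fin.toℕ-inject≤ (idx l) _)) (Fin.toℕ<n (idx l))

    relation-kills-i : ∀ γ → RowRelation (Section M p j) γ → combination γ i ≡ 0#
    relation-kills-i γ rel = section-relation {M = M} {p} γ rel i j<i

    relation'-kills-i : ∀ γ → RowRelation (λ x → Section M' p' j (subst Fin (sym secRows-ins) x)) γ →
                        combination γ i ≡ 0#
    relation'-kills-i γ rel' = coefficient-zero γ combination≡tW
      where
        combination≡tW : ∀ col → toℕ j < toℕ col → combination γ col ≡ combination γ i * W col
        combination≡tW = shift-elim j (λ col → combination γ col ≡ combination γ i * W col)
          (λ col' → x+y*-z≡0⇒x≡y*z _ _ _ (trans (sym (·-rankOne section-rankOne γ col')) (rel' col')))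

    sections-equivalent : EquivalentSections M p M' p' j
    sections-equivalent = secRows-ins , λ S →
      ⇔.trans (rowsIndep-rankOne section-rankOne relation-kills-i relation'-kills-i S)
              (rowsIndep-subst secRows-ins (Section M' p' j) S)

  module Deletion {k n} {M : Mat (suc k) n} {p : Fin (suc k) → Fin n} (rref : IsRREF M p)
    {j : Fin n} {r : Fin (suc k)} (j<pr : toℕ j < toℕ (p r))
    {M' : Mat k n} {p' : Fin k → Fin n} (del : IsDel M p r M') (rref' : IsRREF M' p') where

    open IsRREF rref using (increasing; zeroBefore; leadingOne; pivotCol)
    open DelData M p r using (N₀)
    open IsDel del using (s; idx; basis; b; d; d-basis; d-other; rows)

    ρ : Fin (secRows p j) → Fin (suc k)
    ρ x = inject≤ x (secRows≤ p j)

    m≤r : secRows p j ≤ toℕ r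
    m≤r = ≤-fromFin (secRows≤ p j) λ y y<m →
      increasing-reflects-< increasing (ℕ.≤-<-trans (Equivalence.to (secRows-spec increasing j y) y<m) j<pr)

    ρ<r : ∀ x → toℕ (ρ x) < toℕ r
    ρ<r x = subst (_< toℕ r) (sym (Fin.toℕ-inject≤ x _)) (ℕ.<-≤-trans (Fin.toℕ<n x) m≤r)

    row-r-vanishes : VanishesUpTo M j r
    row-r-vanishes col col≤j = zeroBefore r col (ℕ.≤-<-trans col≤j j<pr)

    secRows-del : secRows p' j ≡ secRows p j
    secRows-del = secRows-deleteVanishingRow rref rref' r row-r-vanishes
                    (λ y col col≤j → trans (rows y col) (x+y*z≡x _ _ (row-r-vanishes col col≤j)))

    section-rankOne : ∀ x col → Section M' p' j (subst Fin (sym secRows-del) x) col ≡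
                                Section M p j x col + d (ρ x) * M r (shift j col)
    section-rankOne x col = trans (rows y (shift j col)) (cong (λ z → M z (shift j col) + d z * M r (shift j col)) punchIn≡ρ)
      where
        y = inject≤ (subst Fin (sym secRows-del) x) (secRows≤ p' j)
        toℕy≡x : toℕ y ≡ toℕ x
        toℕy≡x = toℕ-inject≤-subst secRows-del x (secRows≤ p' j)
        punchIn≡ρ : punchIn r y ≡ ρ x
        punchIn≡ρ = Fin.toℕ-injective (trans (toℕ-punchIn-< r y (subst (_< toℕ r) (trans (Fin.toℕ-inject≤ x _) (sym toℕy≡x)) (ρ<r x)))
                                             (trans toℕy≡x (sym (Fin.toℕ-inject≤ x _))))

    combination : (Fin (secRows p j) → F) → Fin n → F
    combination γ col = γ · (λ x → M (ρ x) col)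

    coordinates : ∀ u → Σ (Fin s → F) λ α →
      (∀ col → N₀ u col ≡ α · (λ l → N₀ (idx l) col)) × d (Fin.inject u) ≡ α · b
    coordinates u with Fin.any? (λ l → idx l Fin.≟ u)
    ... | yes (l , refl) = (λ l' → δ l' l) ,
          (λ col → sym (trans (·-comm _ (λ l' → N₀ (idx l') col)) (sumF-δ (λ l' → N₀ (idx l') col) l))) ,
          trans (d-basis l) (sym (trans (·-comm _ b) (sumF-δ b l)))
    ... | no  u∉idx = d-other u (λ l idxl≡u → u∉idx (l , idxl≡u))

    relation-kills-d : ∀ γ → RowRelation (Section M p j) γ → γ · (λ x → d (ρ x)) ≡ 0#
    relation-kills-d γ rel =
      relation-respects-coordinates (λ x → proj₁ (coordinates (row x))) (lexFirstBasis-independent basis)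
        (λ x → proj₁ (proj₂ (coordinates (row x))))
        (λ x → trans (cong d (sym (inject-row x))) (proj₂ (proj₂ (coordinates (row x)))))
        γ relation-beyond-pr
      where
        row : Fin (secRows p j) → Fin (toℕ r)
        row x = inject≤ x m≤r
        inject-row : ∀ x → Fin.inject (row x) ≡ ρ x
        inject-row x = Fin.toℕ-injective (trans (Fin.toℕ-inject (row x))
                         (trans (Fin.toℕ-inject≤ x m≤r) (sym (Fin.toℕ-inject≤ x _))))
        relation-beyond-pr : RowRelation (λ x → N₀ (row x)) γ
        relation-beyond-pr col = trans (sumF-cong (λ x → cong (λ z → γ x * M z (shift (p r) col)) (inject-row x)))
          (section-relation {M = M} {p} γ rel (shift (p r) col) (ℕ.<-trans j<pr (j<shift (p r) col)))

    -- in the pivot column of row r only the update term survives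
    relation'-kills-d : ∀ γ → RowRelation (λ x → Section M' p' j (subst Fin (sym secRows-del) x)) γ →
                        γ · (λ x → d (ρ x)) ≡ 0#
    relation'-kills-d γ rel' = begin
      t                                    ≡⟨ sym (*-identityʳ t) ⟩
      t * 1#                               ≡⟨ cong (t *_) (sym (leadingOne r)) ⟩
      t * M r (p r)                        ≡⟨ sym (+-identityˡ _) ⟩
      0# + t * M r (p r)                   ≡⟨ cong (_+ t * M r (p r)) (sym combination-pr≡0) ⟩
      combination γ (p r) + t * M r (p r)  ≡⟨ shift-elim j (λ col → combination γ col + t * M r col ≡ 0#)
                                                (λ c' → trans (sym (·-rankOne section-rankOne γ c')) (rel' c')) (p r) j<pr ⟩
      0#                                   ∎
      where
        open ≡-Reasoning
        t = γ · (λ x → d (ρ x))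
        combination-pr≡0 : combination γ (p r) ≡ 0#
        combination-pr≡0 = sumF-zero λ x →
          trans (cong (γ x *_) (pivotCol r (ρ x) λ ρx≡r → ℕ.<-irrefl (cong toℕ ρx≡r) (ρ<r x))) (zeroʳ (γ x))

    sections-equivalent : EquivalentSections M p M' p' j
    sections-equivalent = secRows-del , λ S →
      ⇔.trans (rowsIndep-rankOne section-rankOne relation-kills-d relation'-kills-d S)
              (rowsIndep-subst secRows-del (Section M' p' j) S)

  deletion-equivalentSections : ∀ {k n} {M : Mat k n} {p : Fin k → Fin n} → IsRREF M p →
    ∀ {j} (r : Fin k) → toℕ j < toℕ (p r) →
    ∀ {M' : Mat (pred k) n} {p'} → IsDel M p r M' → IsRREF M' p' → EquivalentSections M p M' p' j
  deletion-equivalentSections {suc k} rref r j<pr del rref' = Deletion.sections-equivalent rref j<pr del rref'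


mainTheorem10 : (𝔽 : FiniteField) → let open Over 𝔽 in
    ∀ {k n : ℕ} → 1 ≤ n →
    (M : Mat k n) (p : Fin k → Fin n) → IsRREF M p →
    (j i : Fin n) → toℕ j < toℕ i →
    Inessential M p j → Inessential M p i → NonPivotal p j →
    (NonPivotal p i →
      ∀ (M' : Mat (suc k) n) (p' : Fin (suc k) → Fin n) →
      IsIns M p i M' → IsRREF M' p' →
      Σ (secRows p' j ≡ secRows p j) λ eq →
        ∀ (S : Subset (secRows p j)) →
          RowsIndep (Section M p j) S ⇔
          RowsIndep (Section M' p' j) (subst Subset (sym eq) S))
    ×
    (∀ (r : Fin k) → p r ≡ i →
      ∀ (M' : Mat (pred k) n) (p' : Fin (pred k) → Fin n) →
      IsDel M p r M' → IsRREF M' p' →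
      Σ (secRows p' j ≡ secRows p j) λ eq →
        ∀ (S : Subset (secRows p j)) →
          RowsIndep (Section M p j) S ⇔
          RowsIndep (Section M' p' j) (subst Subset (sym eq) S))
mainTheorem10 𝔽 _ M p rref j i j<i _ i-inessential _ =
  (λ i-nonpivotal M' p' ins rref' → Insertion.sections-equivalent 𝔽 rref j<i i-inessential i-nonpivotal ins rref') ,
  (λ r pr≡i M' p' del rref' →
     deletion-equivalentSections 𝔽 rref r (subst (λ c → toℕ j < toℕ c) (sym pr≡i) j<i) del rref')
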